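{- Let $w \in \{1,2,3\}^{\mathbb{N}}$ be such that $\rho_w(n) \le 3$ for every positive integer $n$ and $w$ admits letter frequencies which are rationally independent. Let $\ell$ be a positive integer such that there exist $u, v \in \mathcal{L}_\ell(w)$ with $|u|_1 - |v|_1 = 2$. Then, up to exchanging the roles of the letters $2$ and $3$, there exist $r,s,t \in \mathbb{N}$ such that $$\mathrm{ab}(\mathcal{L}_\ell(w)) = \left\{ {}^t(r,s,t),\ {}^t(r+1,s-1,t),\ {}^t(r+2,s-1,t-1) \right\}.$$
   Context: For an infinite word $w$, $\mathcal{L}_n(w)$ is the set of length-$n$ factors (contiguous subwords), $|u|_i$ counts occurrences of the letter $i$ in $u$, letter frequencies are $f_w(i) = \lim_n |\mathrm{pref}_n(w)|_i/n$ with $\mathrm{pref}_n(w)$ the length-$n$ prefix; rationally independent means linearly independent over $\mathbb{Q}$. The abelianized vector of a finite word $u$ over $\{1,2,3\}$ is $\mathrm{ab}(u) = {}^t(|u|_1,|u|_2,|u|_3)$, and $\mathrm{ab}(\mathcal{L}_\ell(w)) = \{\mathrm{ab}(u) : u \in \mathcal{L}_\ell(w)\}$. Two finite words are abelian equivalent if they have the same abelianized vector; $\rho_w(n)$ is the number of abelian equivalence classes of $\mathcal{L}_n(w)$. -}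

module Defs where

open import Data.Nat using (ℕ; zero; suc; _∸_; _≤_)
open import Data.Fin using (Fin)
open import Data.Fin.Patterns using (0F; 1F; 2F)
open import Data.Product using (Σ; ∃; _×_; _,_)
open import Data.Sum using (_⊎_)
open import Data.Integer using (+_)
open import Data.Rational using (ℚ; _/_; 0ℚ; _+_; _*_; _-_; ∣_∣; _<_)
open import Relation.Binary.PropositionalEquality using (_≡_; _≢_)
open import Relation.Nullary using (¬_; Dec; yes; no)
open import Data.Fin using (_≟_)

-- An infinite word over {1,2,3}; letter 1 ↦ 0F, 2 ↦ 1F, 3 ↦ 2F.
Word : Set
Word = ℕ → Fin 3

-- cnt w a i n = |u|_a where u = w(i) w(i+1) ... w(i+n-1) is the length-n
-- factor of w occurring at position i.
cnt : Word → Fin 3 → ℕ → ℕ → ℕ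
cnt w a i zero = 0
cnt w a i (suc n) with w i ≟ a
... | yes _ = suc (cnt w a (suc i) n)
... | no  _ = cnt w a (suc i) n

Vec3 : Set
Vec3 = ℕ × ℕ × ℕ

ab : Word → ℕ → ℕ → Vec3
ab w i n = cnt w 0F i n , cnt w 1F i n , cnt w 2F i n

-- ρ_w(n) ≤ k : the set ab(L_n(w)) of abelian classes of length-n factors has
-- at most k elements, i.e. is covered by k vectors.
ρ≤ : Word → ℕ → ℕ → Set
ρ≤ w n k = Σ (Fin k → Vec3) λ c → ∀ i → ∃ λ j → ab w i n ≡ c j

AbSetIs : Word → ℕ → Vec3 → Vec3 → Vec3 → Set
AbSetIs w ℓ A B C =
  (∀ i → ab w i ℓ ≡ A ⊎ (ab w i ℓ ≡ B ⊎ ab w i ℓ ≡ C))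
  × (∃ λ i → ab w i ℓ ≡ A) × (∃ λ i → ab w i ℓ ≡ B) × (∃ λ i → ab w i ℓ ≡ C)

x : Word → Fin 3 → ℕ → ℚ
x w a n = (+ cnt w a 0 (suc n)) / suc n

-- Real numbers as (Cauchy) limits of rational sequences.
IsCauchy : (ℕ → ℚ) → Set
IsCauchy s = ∀ (ε : ℚ) → 0ℚ < ε → ∃ λ N → ∀ m n → N ≤ m → N ≤ n → ∣ s m - s n ∣ < ε

TendsToZero : (ℕ → ℚ) → Set
TendsToZero s = ∀ (ε : ℚ) → 0ℚ < ε → ∃ λ N → ∀ n → N ≤ n → ∣ s n ∣ < ε

HasFrequencies : Word → Set
HasFrequencies w = ∀ a → IsCauchy (x w a)

-- The frequencies f(1), f(2), f(3) are linearly independent over ℚ: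
-- for every nonzero (q₁,q₂,q₃) ∈ ℚ³, q₁ f(1) + q₂ f(2) + q₃ f(3) ≠ 0, where
-- this combination is the limit of the corresponding combination of the
-- approximating sequences.
FreqRatIndep : Word → Set
FreqRatIndep w = ∀ (q₁ q₂ q₃ : ℚ) → ¬ (q₁ ≡ 0ℚ × q₂ ≡ 0ℚ × q₃ ≡ 0ℚ) →
  ¬ TendsToZero (λ n → q₁ * x w 0F n + q₂ * x w 1F n + q₃ * x w 2F n)

{-# OPTIONS --safe #-}
-- Sliding a window of length ℓ one step changes its number of 1s by at most one, and an
-- increase trades a 2 or a 3 for a 1. So between windows with m and m + 2 ones there are
-- occurring classes X ⇝ Y and Y′ ⇝ Z with 1-counts m, m + 1 and m + 1, m + 2. Having distinct
-- 1-counts, X, Y, Z are all of the at most three classes, hence Y′ = Y. If both trades are of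
-- the same kind, some letter a occurs exactly t times in every window of length ℓ; then
-- t·N − ℓ·|pref_N(w)|_a stays bounded, so t f(1) + t f(2) + t f(3) − ℓ f(a) = 0, contradicting
-- rational independence. Otherwise X, Y, Z form one of the two staircases of the statement.

module Submission where

open import Defs
open import Data.Nat using (ℕ; zero; suc; _+_; _*_; _∸_; _≤_; _<_; _⊔_; z≤n; s≤s; s≤s⁻¹; _≤?_; _<?_; NonZero; >-nonZero; ≢-nonZero⁻¹)
open import Data.Nat.Properties hiding (_≟_)
open import Data.Nat.DivMod using (_/_; _%_; m≡m%n+[m/n]*n; m%n<n)
open import Data.Nat.Tactic.RingSolver using (solve-∀)
open import Data.Integer as ℤ using (ℤ; +_; +0; +[1+_]; -[1+_]; 0ℤ; _⊖_)
import Data.Integer.Properties as ℤₚ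
open import Data.Integer.GCD using (gcd)
import Data.Integer.Tactic.RingSolver as ℤ-Solver
open import Data.Rational as ℚ using (ℚ; 0ℚ; mkℚ; toℚᵘ)
import Data.Rational.Properties as ℚₚ
open import Data.Rational.Unnormalised as ℚᵘ using (mkℚᵘ; *≡*; *<*)
import Data.Rational.Unnormalised.Properties as ℚᵘₚ
open import Data.Fin using (Fin; _≟_)
open import Data.Fin.Patterns using (0F; 1F; 2F)
open import Data.Fin.Properties using (all?)
open import Data.Product using (∃; _×_; _,_; proj₁; proj₂)
open import Data.Sum using (_⊎_; inj₁; inj₂; [_,_])
import Data.Sum as Sum
open import Data.Empty using (⊥-elim)
open import Function using (_∘_)
open import Relation.Nullary using (¬_; yes; no)
open import Relation.Nullary.Decidable using (from-yes; ¬?; _→-dec_; _⊎-dec_)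
open import Relation.Unary using (Pred; Decidable)
open import Relation.Binary.PropositionalEquality using (_≡_; _≢_; refl; sym; trans; cong; cong₂; subst; subst₂; module ≡-Reasoning)

δ : Fin 3 → Fin 3 → ℕ
δ b a with b ≟ a
... | yes _ = 1
... | no  _ = 0

δ-total : ∀ b → δ b 0F + δ b 1F + δ b 2F ≡ 1
δ-total 0F = refl
δ-total 1F = refl
δ-total 2F = refl

cnt-suc : ∀ w a i n → cnt w a i (suc n) ≡ δ (w i) a + cnt w a (suc i) n
cnt-suc w a i n with w i ≟ a
... | yes _ = refl
... | no  _ = refl

cnt≤ : ∀ w a i n → cnt w a i n ≤ n
cnt≤ w a i zero = z≤n
cnt≤ w a i (suc n) with w i ≟ a
... | yes _ = s≤s (cnt≤ w a (suc i) n)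
... | no  _ = m≤n⇒m≤1+n (cnt≤ w a (suc i) n)

cnt-+ : ∀ w a i m n → cnt w a i (m + n) ≡ cnt w a i m + cnt w a (i + m) n
cnt-+ w a i zero n = cong (λ j → cnt w a j n) (sym (+-identityʳ i))
cnt-+ w a i (suc m) n = begin
  cnt w a i (suc (m + n))                                         ≡⟨ cnt-suc w a i (m + n) ⟩
  δ (w i) a + cnt w a (suc i) (m + n)                             ≡⟨ cong (_+_ (δ (w i) a)) (cnt-+ w a (suc i) m n) ⟩
  δ (w i) a + (cnt w a (suc i) m + cnt w a (suc i + m) n)         ≡⟨ +-assoc (δ (w i) a) _ _ ⟨
  δ (w i) a + cnt w a (suc i) m + cnt w a (suc i + m) n           ≡⟨ cong₂ _+_ (cnt-suc w a i m) (cong (λ j → cnt w a j n) (+-suc i m)) ⟨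
  cnt w a i (suc m) + cnt w a (i + suc m) n                       ∎
  where open ≡-Reasoning

cnt-slide : ∀ w a i n → δ (w (i + n)) a + cnt w a i n ≡ δ (w i) a + cnt w a (suc i) n
cnt-slide w a i n = begin
  δ (w (i + n)) a + cnt w a i n    ≡⟨ +-comm _ (cnt w a i n) ⟩
  cnt w a i n + δ (w (i + n)) a    ≡⟨ cong (_+_ (cnt w a i n)) (trans (cnt-suc w a (i + n) 0) (+-identityʳ _)) ⟨
  cnt w a i n + cnt w a (i + n) 1  ≡⟨ cnt-+ w a i n 1 ⟨
  cnt w a i (n + 1)                ≡⟨ cong (cnt w a i) (+-comm n 1) ⟩
  cnt w a i (suc n)                ≡⟨ cnt-suc w a i n ⟩
  δ (w i) a + cnt w a (suc i) n    ∎
  where open ≡-Reasoning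

cnt-total : ∀ w i n → cnt w 0F i n + cnt w 1F i n + cnt w 2F i n ≡ n
cnt-total w i zero = refl
cnt-total w i (suc n) = begin
  cnt w 0F i (suc n) + cnt w 1F i (suc n) + cnt w 2F i (suc n)
    ≡⟨ cong₂ _+_ (cong₂ _+_ (cnt-suc w 0F i n) (cnt-suc w 1F i n)) (cnt-suc w 2F i n) ⟩
  δ (w i) 0F + c₀ + (δ (w i) 1F + c₁) + (δ (w i) 2F + c₂)
    ≡⟨ interchange (δ (w i) 0F) (δ (w i) 1F) (δ (w i) 2F) c₀ c₁ c₂ ⟩
  (δ (w i) 0F + δ (w i) 1F + δ (w i) 2F) + (c₀ + c₁ + c₂)
    ≡⟨ cong₂ _+_ (δ-total (w i)) (cnt-total w (suc i) n) ⟩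
  suc n ∎
  where
  open ≡-Reasoning
  c₀ = cnt w 0F (suc i) n
  c₁ = cnt w 1F (suc i) n
  c₂ = cnt w 2F (suc i) n
  interchange : ∀ a b c d e f → a + d + (b + e) + (c + f) ≡ (a + b + c) + (d + e + f)
  interchange = solve-∀

cnt-blocks : ∀ w a ℓ t → (∀ i → cnt w a i ℓ ≡ t) → ∀ k i → cnt w a i (k * ℓ) ≡ k * t
cnt-blocks w a ℓ t const zero i = refl
cnt-blocks w a ℓ t const (suc k) i =
  trans (cnt-+ w a i ℓ (k * ℓ)) (cong₂ _+_ (const i) (cnt-blocks w a ℓ t const k (i + ℓ)))

data _⇝_ : Vec3 → Vec3 → Set where
  trade₂ : ∀ {r s t} → (r , suc s , t) ⇝ (suc r , s , t)
  trade₃ : ∀ {r s t} → (r , s , suc t) ⇝ (suc r , s , t)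

⇝-suc : ∀ {X Y} → X ⇝ Y → proj₁ Y ≡ suc (proj₁ X)
⇝-suc trade₂ = refl
⇝-suc trade₃ = refl

trade₂-of : ∀ {a b c a′ b′ c′} → suc a ≡ a′ → b ≡ suc b′ → c ≡ c′ → (a , b , c) ⇝ (a′ , b′ , c′)
trade₂-of refl refl refl = trade₂

trade₃-of : ∀ {a b c a′ b′ c′} → suc a ≡ a′ → b ≡ b′ → c ≡ suc c′ → (a , b , c) ⇝ (a′ , b′ , c′)
trade₃-of refl refl refl = trade₃

window-slide : ∀ w ℓ i →
  ab w i ℓ ⇝ ab w (suc i) ℓ ⊎ ab w (suc i) ℓ ⇝ ab w i ℓ ⊎ cnt w 0F i ℓ ≡ cnt w 0F (suc i) ℓ
window-slide w ℓ i with w i | w (i + ℓ) | cnt-slide w 0F i ℓ | cnt-slide w 1F i ℓ | cnt-slide w 2F i ℓ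
... | 1F | 0F | e₀ | e₁ | e₂ = inj₁ (trade₂-of e₀ e₁ e₂)
... | 2F | 0F | e₀ | e₁ | e₂ = inj₁ (trade₃-of e₀ e₁ e₂)
... | 0F | 1F | e₀ | e₁ | e₂ = inj₂ (inj₁ (trade₂-of (sym e₀) (sym e₁) (sym e₂)))
... | 0F | 2F | e₀ | e₁ | e₂ = inj₂ (inj₁ (trade₃-of (sym e₀) (sym e₁) (sym e₂)))
... | 0F | 0F | e₀ | _  | _  = inj₂ (inj₂ (suc-injective e₀))
... | 1F | 1F | e₀ | _  | _  = inj₂ (inj₂ e₀)
... | 1F | 2F | e₀ | _  | _  = inj₂ (inj₂ e₀)
... | 2F | 1F | e₀ | _  | _  = inj₂ (inj₂ e₀)
... | 2F | 2F | e₀ | _  | _  = inj₂ (inj₂ e₀)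

flip-point : ∀ {p} {P : Pred ℕ p} → Decidable P → ∀ i d → P i → ¬ P (i + d) → ∃ λ j → P j × ¬ P (suc j)
flip-point {P = P} P? i zero Pi ¬Pi = ⊥-elim (¬Pi (subst P (sym (+-identityʳ i)) Pi))
flip-point {P = P} P? i (suc d) Pi ¬Pi+d with P? (suc i)
... | yes Psi = flip-point P? (suc i) d Psi (¬Pi+d ∘ subst P (sym (+-suc i d)))
... | no ¬Psi = i , Pi , ¬Psi

Occurs : Word → ℕ → Vec3 → Set
Occurs w ℓ X = ∃ λ i → ab w i ℓ ≡ X

record Crossing (w : Word) (ℓ m : ℕ) : Set where
  constructor crossing
  field
    lower upper  : Vec3
    trade        : lower ⇝ upper
    at-level     : proj₁ lower ≡ m
    lower-occurs : Occurs w ℓ lower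
    upper-occurs : Occurs w ℓ upper

crossing-up : ∀ w ℓ m i → cnt w 0F i ℓ ≤ m → m < cnt w 0F (suc i) ℓ → Crossing w ℓ m
crossing-up w ℓ m i i≤m m<si with window-slide w ℓ i
... | inj₁ X⇝Y =
  crossing _ _ X⇝Y (≤-antisym i≤m (s≤s⁻¹ (≤-trans m<si (≤-reflexive (⇝-suc X⇝Y))))) (i , refl) (suc i , refl)
... | inj₂ (inj₁ Y⇝X) = ⊥-elim (<⇒≱ m<si (≤-trans (n≤1+n _) (subst (_≤ m) (⇝-suc Y⇝X) i≤m)))
... | inj₂ (inj₂ same) = ⊥-elim (<⇒≱ m<si (subst (_≤ m) same i≤m))

crossing-down : ∀ w ℓ m i → m < cnt w 0F i ℓ → cnt w 0F (suc i) ℓ ≤ m → Crossing w ℓ m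
crossing-down w ℓ m i m<i si≤m with window-slide w ℓ i
... | inj₂ (inj₁ Y⇝X) =
  crossing _ _ Y⇝X (≤-antisym si≤m (s≤s⁻¹ (≤-trans m<i (≤-reflexive (⇝-suc Y⇝X))))) (suc i , refl) (i , refl)
... | inj₁ X⇝Y = ⊥-elim (<⇒≱ m<i (≤-trans (n≤1+n _) (subst (_≤ m) (⇝-suc X⇝Y) si≤m)))
... | inj₂ (inj₂ same) = ⊥-elim (<⇒≱ m<i (subst (_≤ m) (sym same) si≤m))

level-crossing : ∀ w ℓ m p q → cnt w 0F p ℓ ≤ m → m < cnt w 0F q ℓ → Crossing w ℓ m
level-crossing w ℓ m p q p≤m m<q = [ upward , downward ] (≤-total p q)
  where
  f : ℕ → ℕ
  f k = cnt w 0F k ℓ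
  upward : p ≤ q → Crossing w ℓ m
  upward p≤q =
    let i , i≤m , si≰m = flip-point (λ k → f k ≤? m) p (q ∸ p) p≤m
                           (λ q≤m → <⇒≱ m<q (subst (λ k → f k ≤ m) (m+[n∸m]≡n p≤q) q≤m))
    in crossing-up w ℓ m i i≤m (≰⇒> si≰m)
  downward : q ≤ p → Crossing w ℓ m
  downward q≤p =
    let i , m<i , m≮si = flip-point (λ k → m <? f k) q (p ∸ q) m<q
                           (λ m<p → <⇒≱ m<p (subst (λ k → f k ≤ m) (sym (m+[n∸m]≡n q≤p)) p≤m))
    in crossing-down w ℓ m i m<i (≮⇒≥ m≮si)

distinct⇒exhaustive : ∀ (a b c j : Fin 3) → a ≢ b → a ≢ c → b ≢ c → j ≡ a ⊎ j ≡ b ⊎ j ≡ c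
distinct⇒exhaustive = from-yes
  (all? λ (a : Fin 3) → all? λ (b : Fin 3) → all? λ (c : Fin 3) → all? λ (j : Fin 3) →
    ¬? (a ≟ b) →-dec ¬? (a ≟ c) →-dec ¬? (b ≟ c) →-dec (j ≟ a ⊎-dec j ≟ b ⊎-dec j ≟ c))

three-classes : ∀ {w ℓ X Y Z} → ρ≤ w ℓ 3 → Occurs w ℓ X → Occurs w ℓ Y → Occurs w ℓ Z →
  X ≢ Y → X ≢ Z → Y ≢ Z → AbSetIs w ℓ X Y Z
three-classes {w} {ℓ} {X} {Y} {Z} (c , cover) oX oY oZ X≢Y X≢Z Y≢Z =
  covered , oX , oY , oZ
  where
  class : ∀ {V} → Occurs w ℓ V → ∃ λ j → V ≡ c j
  class (i , refl) = cover i
  distinct : ∀ {U V} (oU : Occurs w ℓ U) (oV : Occurs w ℓ V) → U ≢ V → proj₁ (class oU) ≢ proj₁ (class oV)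
  distinct oU oV U≢V jU≡jV = U≢V (trans (proj₂ (class oU)) (trans (cong c jU≡jV) (sym (proj₂ (class oV)))))
  covered : ∀ i → ab w i ℓ ≡ X ⊎ ab w i ℓ ≡ Y ⊎ ab w i ℓ ≡ Z
  covered i =
    let j , e = cover i
        into : ∀ {V} (oV : Occurs w ℓ V) → j ≡ proj₁ (class oV) → ab w i ℓ ≡ V
        into oV j≡jV = trans e (trans (cong c j≡jV) (sym (proj₂ (class oV))))
    in Sum.map (into oX) (Sum.map (into oY) (into oZ))
         (distinct⇒exhaustive _ _ _ j (distinct oX oY X≢Y) (distinct oX oZ X≢Z) (distinct oY oZ Y≢Z))

middle-class : ∀ {w ℓ X Y Z V} → AbSetIs w ℓ X Y Z → Occurs w ℓ V → V ≢ X → V ≢ Z → V ≡ Y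
middle-class (cover , _) (i , refl) V≢X V≢Z with cover i
... | inj₁ V≡X        = ⊥-elim (V≢X V≡X)
... | inj₂ (inj₁ V≡Y) = V≡Y
... | inj₂ (inj₂ V≡Z) = ⊥-elim (V≢Z V≡Z)

AbSetIs⇒constant : ∀ {w ℓ X Y Z k} (π : Vec3 → ℕ) → AbSetIs w ℓ X Y Z →
  π X ≡ k → π Y ≡ k → π Z ≡ k → ∀ i → π (ab w i ℓ) ≡ k
AbSetIs⇒constant π (cover , _) πX πY πZ i =
  [ (λ e → trans (cong π e) πX) , [ (λ e → trans (cong π e) πY) , (λ e → trans (cong π e) πZ) ] ] (cover i)

TendsToZero-cong : ∀ {f g} → (∀ n → f n ≡ g n) → TendsToZero f → TendsToZero g
TendsToZero-cong f≡g f→0 ε ε>0 =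
  let N , small = f→0 ε ε>0
  in N , λ n N≤n → subst (λ q → ℚ.∣ q ∣ ℚ.< ε) (f≡g n) (small n N≤n)

bounded/suc⇒TendsToZero : ∀ (f : ℕ → ℤ) K → (∀ n → ℤ.∣ f n ∣ ≤ K) → TendsToZero (λ n → f n ℚ./ suc n)
bounded/suc⇒TendsToZero f K bounded ε ε>0 = go ε (ℚ.positive ε>0)
  where
  go : ∀ ε → ℚ.Positive ε → ∃ λ N → ∀ n → N ≤ n → ℚ.∣ f n ℚ./ suc n ∣ ℚ.< ε
  -- For ε = (a + 1)/(d + 1): |f n|/(n + 1) ≤ K/(n + 1) < ε as soon as n ≥ K (d + 1).
  go (mkℚ +[1+ a ] d _) _ = K * suc d , λ n N≤n →
    ℚₚ.toℚᵘ-cancel-<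
      (ℚᵘₚ.<-respˡ-≃ (ℚᵘₚ.≃-sym (ℚᵘₚ.≃-trans (ℚₚ.toℚᵘ-homo-∣-∣ (f n ℚ./ suc n))
                                             (ℚᵘₚ.∣-∣-cong (ℚₚ.toℚᵘ-fromℚᵘ (mkℚᵘ (f n) n)))))
        (*<* (subst₂ ℤ._<_ (ℤₚ.pos-* ℤ.∣ f n ∣ (suc d)) (ℤₚ.pos-* (suc a) (suc n)) (ℤ.+<+ (begin-strict
          ℤ.∣ f n ∣ * suc d  ≤⟨ *-monoˡ-≤ (suc d) (bounded n) ⟩
          K * suc d          ≤⟨ N≤n ⟩
          n                  <⟨ n<1+n n ⟩
          suc n              ≤⟨ m≤n*m (suc n) (suc a) ⟩
          suc a * suc n      ∎)))))
    where open ≤-Reasoning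
  go (mkℚ +0 _ _) ()
  go (mkℚ -[1+ _ ] _ _) ()

/≡0⇒≡0 : ∀ {i n} .{{_ : NonZero n}} → i ℚ./ n ≡ 0ℚ → i ≡ 0ℤ
/≡0⇒≡0 {i} {n} i/n≡0 = trans (sym (ℚₚ.↥-/ i n)) (cong (λ q → ℚ.↥ q ℤ.* gcd i (+ n)) i/n≡0)

prefixCombination : Word → (Fin 3 → ℤ) → ℕ → ℤ
prefixCombination w z n =
  z 0F ℤ.* + cnt w 0F 0 n ℤ.+ z 1F ℤ.* + cnt w 1F 0 n ℤ.+ z 2F ℤ.* + cnt w 2F 0 n

frequencyCombination : Word → (Fin 3 → ℤ) → ℕ → ℚ
frequencyCombination w z n =
  (z 0F ℚ./ 1) ℚ.* x w 0F n ℚ.+ (z 1F ℚ./ 1) ℚ.* x w 1F n ℚ.+ (z 2F ℚ./ 1) ℚ.* x w 2F n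

mkℚᵘ-+ : ∀ i j n → mkℚᵘ i n ℚᵘ.+ mkℚᵘ j n ℚᵘ.≃ mkℚᵘ (i ℤ.+ j) n
mkℚᵘ-+ i j n = *≡* (trans (regroup i j (+ suc n)) (cong (ℤ._*_ (i ℤ.+ j)) (sym (ℤₚ.pos-* (suc n) (suc n)))))
  where
  regroup : ∀ i j d → (i ℤ.* d ℤ.+ j ℤ.* d) ℤ.* d ≡ (i ℤ.+ j) ℤ.* (d ℤ.* d)
  regroup = ℤ-Solver.solve-∀

toℚᵘ-/1-*-/suc : ∀ i j n → toℚᵘ ((i ℚ./ 1) ℚ.* (j ℚ./ suc n)) ℚᵘ.≃ mkℚᵘ (i ℤ.* j) n
toℚᵘ-/1-*-/suc i j n = ℚᵘₚ.≃-trans (ℚₚ.toℚᵘ-homo-* (i ℚ./ 1) (j ℚ./ suc n))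
  (ℚᵘₚ.≃-trans (ℚᵘₚ.*-cong (ℚₚ.toℚᵘ-fromℚᵘ (mkℚᵘ i 0)) (ℚₚ.toℚᵘ-fromℚᵘ (mkℚᵘ j n)))
               (*≡* (cong (ℤ._*_ (i ℤ.* j)) (cong +_ (sym (*-identityˡ (suc n)))))))

frequencyCombination≡ : ∀ w z n → frequencyCombination w z n ≡ prefixCombination w z (suc n) ℚ./ suc n
frequencyCombination≡ w z n = ℚₚ.toℚᵘ-injective (begin
  toℚᵘ (A ℚ.+ B ℚ.+ C)                      ≈⟨ ℚₚ.toℚᵘ-homo-+ (A ℚ.+ B) C ⟩
  toℚᵘ (A ℚ.+ B) ℚᵘ.+ toℚᵘ C                ≈⟨ ℚᵘₚ.+-congˡ (toℚᵘ C) (ℚₚ.toℚᵘ-homo-+ A B) ⟩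
  toℚᵘ A ℚᵘ.+ toℚᵘ B ℚᵘ.+ toℚᵘ C            ≈⟨ ℚᵘₚ.+-cong (ℚᵘₚ.+-cong (scaled 0F) (scaled 1F)) (scaled 2F) ⟩
  mkℚᵘ a n ℚᵘ.+ mkℚᵘ b n ℚᵘ.+ mkℚᵘ c n     ≈⟨ ℚᵘₚ.+-congˡ (mkℚᵘ c n) (mkℚᵘ-+ a b n) ⟩
  mkℚᵘ (a ℤ.+ b) n ℚᵘ.+ mkℚᵘ c n           ≈⟨ mkℚᵘ-+ (a ℤ.+ b) c n ⟩
  mkℚᵘ (a ℤ.+ b ℤ.+ c) n                   ≈⟨ ℚₚ.toℚᵘ-fromℚᵘ (mkℚᵘ (a ℤ.+ b ℤ.+ c) n) ⟨
  toℚᵘ ((a ℤ.+ b ℤ.+ c) ℚ./ suc n)         ∎)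
  where
  open ℚᵘₚ.≃-Reasoning
  A = (z 0F ℚ./ 1) ℚ.* x w 0F n
  B = (z 1F ℚ./ 1) ℚ.* x w 1F n
  C = (z 2F ℚ./ 1) ℚ.* x w 2F n
  a = z 0F ℤ.* + cnt w 0F 0 (suc n)
  b = z 1F ℤ.* + cnt w 1F 0 (suc n)
  c = z 2F ℤ.* + cnt w 2F 0 (suc n)
  scaled : ∀ l → toℚᵘ ((z l ℚ./ 1) ℚ.* x w l n) ℚᵘ.≃ mkℚᵘ (z l ℤ.* + cnt w l 0 (suc n)) n
  scaled l = toℚᵘ-/1-*-/suc (z l) (+ cnt w l 0 (suc n)) n

bounded-combination⇒¬FreqRatIndep : ∀ w z K → ¬ (z 0F ≡ 0ℤ × z 1F ≡ 0ℤ × z 2F ≡ 0ℤ) →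
  (∀ n → ℤ.∣ prefixCombination w z n ∣ ≤ K) → ¬ FreqRatIndep w
bounded-combination⇒¬FreqRatIndep w z K z≢0 bounded indep =
  indep (z 0F ℚ./ 1) (z 1F ℚ./ 1) (z 2F ℚ./ 1)
    (λ (e₀ , e₁ , e₂) → z≢0 (/≡0⇒≡0 e₀ , /≡0⇒≡0 e₁ , /≡0⇒≡0 e₂))
    (TendsToZero-cong (sym ∘ frequencyCombination≡ w z)
      (bounded/suc⇒TendsToZero (prefixCombination w z ∘ suc) K (bounded ∘ suc)))

discrepancyCoefficients : ℕ → ℕ → Fin 3 → Fin 3 → ℤ
discrepancyCoefficients t ℓ a b with b ≟ a
... | yes _ = + t ℤ.- + ℓ
... | no  _ = + t

prefixCombination-discrepancy : ∀ w t ℓ a N →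
  prefixCombination w (discrepancyCoefficients t ℓ a) N ≡ t * N ⊖ ℓ * cnt w a 0 N
prefixCombination-discrepancy w t ℓ a N = begin
  prefixCombination w (discrepancyCoefficients t ℓ a) N        ≡⟨ select a ⟩
  + t ℤ.* (C₀ ℤ.+ C₁ ℤ.+ C₂) ℤ.- + ℓ ℤ.* + cnt w a 0 N         ≡⟨ cong (λ n → + t ℤ.* n ℤ.- + ℓ ℤ.* + cnt w a 0 N) total ⟩
  + t ℤ.* + N ℤ.- + ℓ ℤ.* + cnt w a 0 N                        ≡⟨ cong₂ ℤ._-_ (ℤₚ.pos-* t N) (ℤₚ.pos-* ℓ (cnt w a 0 N)) ⟨
  + (t * N) ℤ.- + (ℓ * cnt w a 0 N)                            ≡⟨ ℤₚ.m-n≡m⊖n (t * N) (ℓ * cnt w a 0 N) ⟩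
  t * N ⊖ ℓ * cnt w a 0 N                                      ∎
  where
  open ≡-Reasoning
  c₀ = cnt w 0F 0 N
  c₁ = cnt w 1F 0 N
  c₂ = cnt w 2F 0 N
  C₀ = + c₀
  C₁ = + c₁
  C₂ = + c₂
  total : C₀ ℤ.+ C₁ ℤ.+ C₂ ≡ + N
  total = sym (trans (cong +_ (sym (cnt-total w 0 N)))
                     (trans (ℤₚ.pos-+ (c₀ + c₁) c₂) (cong (λ n → n ℤ.+ C₂) (ℤₚ.pos-+ c₀ c₁))))
  on-first : ∀ T L c₀ c₁ c₂ → (T ℤ.- L) ℤ.* c₀ ℤ.+ T ℤ.* c₁ ℤ.+ T ℤ.* c₂ ≡ T ℤ.* (c₀ ℤ.+ c₁ ℤ.+ c₂) ℤ.- L ℤ.* c₀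
  on-first = ℤ-Solver.solve-∀
  on-second : ∀ T L c₀ c₁ c₂ → T ℤ.* c₀ ℤ.+ (T ℤ.- L) ℤ.* c₁ ℤ.+ T ℤ.* c₂ ≡ T ℤ.* (c₀ ℤ.+ c₁ ℤ.+ c₂) ℤ.- L ℤ.* c₁
  on-second = ℤ-Solver.solve-∀
  on-third : ∀ T L c₀ c₁ c₂ → T ℤ.* c₀ ℤ.+ T ℤ.* c₁ ℤ.+ (T ℤ.- L) ℤ.* c₂ ≡ T ℤ.* (c₀ ℤ.+ c₁ ℤ.+ c₂) ℤ.- L ℤ.* c₂
  on-third = ℤ-Solver.solve-∀
  select : ∀ a → prefixCombination w (discrepancyCoefficients t ℓ a) N ≡
                 + t ℤ.* (C₀ ℤ.+ C₁ ℤ.+ C₂) ℤ.- + ℓ ℤ.* + cnt w a 0 N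
  select 0F = on-first (+ t) (+ ℓ) C₀ C₁ C₂
  select 1F = on-second (+ t) (+ ℓ) C₀ C₁ C₂
  select 2F = on-third (+ t) (+ ℓ) C₀ C₁ C₂

t≡0∧t-ℓ≡0⇒ℓ≡0 : ∀ {t ℓ} → + t ≡ 0ℤ → + t ℤ.- + ℓ ≡ 0ℤ → ℓ ≡ 0
t≡0∧t-ℓ≡0⇒ℓ≡0 {ℓ = zero}  refl _  = refl
t≡0∧t-ℓ≡0⇒ℓ≡0 {ℓ = suc _} refl ()

discrepancyCoefficients-nonzero : ∀ t ℓ a → ℓ ≢ 0 →
  ¬ (discrepancyCoefficients t ℓ a 0F ≡ 0ℤ × discrepancyCoefficients t ℓ a 1F ≡ 0ℤ × discrepancyCoefficients t ℓ a 2F ≡ 0ℤ)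
discrepancyCoefficients-nonzero t ℓ 0F ℓ≢0 (t-ℓ≡0 , t≡0 , _) = ℓ≢0 (t≡0∧t-ℓ≡0⇒ℓ≡0 t≡0 t-ℓ≡0)
discrepancyCoefficients-nonzero t ℓ 1F ℓ≢0 (t≡0 , t-ℓ≡0 , _) = ℓ≢0 (t≡0∧t-ℓ≡0⇒ℓ≡0 t≡0 t-ℓ≡0)
discrepancyCoefficients-nonzero t ℓ 2F ℓ≢0 (t≡0 , _ , t-ℓ≡0) = ℓ≢0 (t≡0∧t-ℓ≡0⇒ℓ≡0 t≡0 t-ℓ≡0)

constant-count⇒bounded-discrepancy : ∀ w a ℓ t .{{_ : NonZero ℓ}} → (∀ i → cnt w a i ℓ ≡ t) →
  ∀ N → ℤ.∣ t * N ⊖ ℓ * cnt w a 0 N ∣ ≤ ℓ * ℓ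
constant-count⇒bounded-discrepancy w a ℓ t const N = begin
  ℤ.∣ t * N ⊖ ℓ * cnt w a 0 N ∣                       ≡⟨ cong ℤ.∣_∣ (cong₂ _⊖_ tN ℓc) ⟩
  ℤ.∣ ℓ * (k * t) + t * r ⊖ (ℓ * (k * t) + ℓ * c′) ∣  ≡⟨ cong ℤ.∣_∣ (ℤₚ.+-cancelˡ-⊖ (ℓ * (k * t)) _ _) ⟩
  ℤ.∣ t * r ⊖ ℓ * c′ ∣                                ≤⟨ ℤₚ.∣m⊝n∣≤m⊔n (t * r) (ℓ * c′) ⟩
  t * r ⊔ ℓ * c′                                      ≤⟨ ⊔-lub (*-mono-≤ t≤ℓ r≤ℓ) (*-monoʳ-≤ ℓ (≤-trans c′≤r r≤ℓ)) ⟩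
  ℓ * ℓ                                               ∎
  where
  open ≤-Reasoning
  k = N / ℓ
  r = N % ℓ
  c′ = cnt w a (k * ℓ) r
  r≤ℓ : r ≤ ℓ
  r≤ℓ = <⇒≤ (m%n<n N ℓ)
  c′≤r : c′ ≤ r
  c′≤r = cnt≤ w a (k * ℓ) r
  t≤ℓ : t ≤ ℓ
  t≤ℓ = subst (_≤ ℓ) (const 0) (cnt≤ w a 0 ℓ)
  N≡ : N ≡ k * ℓ + r
  N≡ = trans (m≡m%n+[m/n]*n N ℓ) (+-comm r (k * ℓ))
  rearrange : ∀ t k ℓ → t * (k * ℓ) ≡ ℓ * (k * t)
  rearrange = solve-∀
  tN : t * N ≡ ℓ * (k * t) + t * r
  tN = begin-equality
    t * N                  ≡⟨ cong (t *_) N≡ ⟩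
    t * (k * ℓ + r)        ≡⟨ *-distribˡ-+ t (k * ℓ) r ⟩
    t * (k * ℓ) + t * r    ≡⟨ cong (_+ t * r) (rearrange t k ℓ) ⟩
    ℓ * (k * t) + t * r    ∎
  ℓc : ℓ * cnt w a 0 N ≡ ℓ * (k * t) + ℓ * c′
  ℓc = begin-equality
    ℓ * cnt w a 0 N               ≡⟨ cong (λ M → ℓ * cnt w a 0 M) N≡ ⟩
    ℓ * cnt w a 0 (k * ℓ + r)     ≡⟨ cong (ℓ *_) (cnt-+ w a 0 (k * ℓ) r) ⟩
    ℓ * (cnt w a 0 (k * ℓ) + c′)  ≡⟨ cong (λ c → ℓ * (c + c′)) (cnt-blocks w a ℓ t const k 0) ⟩
    ℓ * (k * t + c′)              ≡⟨ *-distribˡ-+ ℓ (k * t) c′ ⟩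
    ℓ * (k * t) + ℓ * c′          ∎

constant-count⇒¬FreqRatIndep : ∀ w a ℓ t .{{_ : NonZero ℓ}} → (∀ i → cnt w a i ℓ ≡ t) → ¬ FreqRatIndep w
constant-count⇒¬FreqRatIndep w a ℓ t const =
  bounded-combination⇒¬FreqRatIndep w (discrepancyCoefficients t ℓ a) (ℓ * ℓ)
    (discrepancyCoefficients-nonzero t ℓ a (≢-nonZero⁻¹ ℓ))
    (λ N → subst (λ d → ℤ.∣ d ∣ ≤ ℓ * ℓ) (sym (prefixCombination-discrepancy w t ℓ a N))
                 (constant-count⇒bounded-discrepancy w a ℓ t const N))

StaircaseClasses : Word → ℕ → Set
StaircaseClasses w ℓ = ∃ λ r → ∃ λ s → ∃ λ t →
  AbSetIs w ℓ (r , s , t) (r + 1 , s ∸ 1 , t) (r + 2 , s ∸ 1 , t ∸ 1)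
  ⊎ AbSetIs w ℓ (r , s , t) (r + 1 , s , t ∸ 1) (r + 2 , s ∸ 1 , t ∸ 1)

two-trades⇒staircase : ∀ {w ℓ X Y Z} .{{_ : NonZero ℓ}} → FreqRatIndep w →
  X ⇝ Y → Y ⇝ Z → AbSetIs w ℓ X Y Z → StaircaseClasses w ℓ
two-trades⇒staircase {w} {ℓ} indep trade₂ trade₂ classes =
  ⊥-elim (constant-count⇒¬FreqRatIndep w 2F ℓ _ (AbSetIs⇒constant {w} {ℓ} (proj₂ ∘ proj₂) classes refl refl refl) indep)
two-trades⇒staircase {w} {ℓ} indep trade₃ trade₃ classes =
  ⊥-elim (constant-count⇒¬FreqRatIndep w 1F ℓ _ (AbSetIs⇒constant {w} {ℓ} (proj₁ ∘ proj₂) classes refl refl refl) indep)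
two-trades⇒staircase {w} {ℓ} {r , suc s , suc t} indep trade₂ trade₃ classes =
  r , suc s , suc t , inj₁ (subst₂ (λ r₁ r₂ → AbSetIs w ℓ (r , suc s , suc t) (r₁ , s , suc t) (r₂ , s , t))
                                   (+-comm 1 r) (+-comm 2 r) classes)
two-trades⇒staircase {w} {ℓ} {r , suc s , suc t} indep trade₃ trade₂ classes =
  r , suc s , suc t , inj₂ (subst₂ (λ r₁ r₂ → AbSetIs w ℓ (r , suc s , suc t) (r₁ , suc s , t) (r₂ , s , t))
                                   (+-comm 1 r) (+-comm 2 r) classes)

consecutive-crossings⇒staircase : ∀ {w ℓ} m .{{_ : NonZero ℓ}} → ρ≤ w ℓ 3 → FreqRatIndep w →
  Crossing w ℓ m → Crossing w ℓ (suc m) → StaircaseClasses w ℓ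
consecutive-crossings⇒staircase {w} {ℓ} m ρ≤3 indep (crossing X Y X⇝Y X-level oX oY) (crossing Y′ Z Y′⇝Z Y′-level oY′ oZ) =
  two-trades⇒staircase indep X⇝Y (subst (_⇝ Z) Y′≡Y Y′⇝Z) classes
  where
  Y-level : proj₁ Y ≡ suc m
  Y-level = trans (⇝-suc X⇝Y) (cong suc X-level)
  Z-level : proj₁ Z ≡ suc (suc m)
  Z-level = trans (⇝-suc Y′⇝Z) (cong suc Y′-level)
  distinct : ∀ {U V a b} → proj₁ U ≡ a → proj₁ V ≡ b → a < b → U ≢ V
  distinct refl refl a<b refl = <-irrefl refl a<b
  classes : AbSetIs w ℓ X Y Z
  classes = three-classes {w} {ℓ} ρ≤3 oX oY oZ
    (distinct X-level Y-level (n<1+n m))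
    (distinct X-level Z-level (m<n⇒m<1+n (n<1+n m)))
    (distinct Y-level Z-level (n<1+n (suc m)))
  Y′≡Y : Y′ ≡ Y
  Y′≡Y = middle-class {w} {ℓ} classes oY′ (distinct X-level Y′-level (n<1+n m) ∘ sym) (distinct Y′-level Z-level (n<1+n (suc m)))

lemma19 : (w : Word) → (∀ n → 1 ≤ n → ρ≤ w n 3) → HasFrequencies w → FreqRatIndep w →
    (ℓ : ℕ) → 1 ≤ ℓ → (∃ λ i → ∃ λ j → cnt w 0F i ℓ ≡ cnt w 0F j ℓ + 2) →
    ∃ λ r → ∃ λ s → ∃ λ t →
      AbSetIs w ℓ (r , s , t) (r + 1 , s ∸ 1 , t) (r + 2 , s ∸ 1 , t ∸ 1)
      ⊎ AbSetIs w ℓ (r , s , t) (r + 1 , s , t ∸ 1) (r + 2 , s ∸ 1 , t ∸ 1)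
lemma19 w ρ≤3 _ indep ℓ 1≤ℓ (i , j , two-more) =
  consecutive-crossings⇒staircase m {{>-nonZero 1≤ℓ}} (ρ≤3 ℓ 1≤ℓ) indep
    (level-crossing w ℓ m j i ≤-refl (≤-trans (n≤1+n (suc m)) m+2≤i))
    (level-crossing w ℓ (suc m) j i (n≤1+n m) m+2≤i)
  where
  m = cnt w 0F j ℓ
  m+2≤i : suc (suc m) ≤ cnt w 0F i ℓ
  m+2≤i = ≤-reflexive (sym (trans two-more (+-comm m 2)))
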